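{- For every $n\ge1$, \[ \sum_{k=0}^n q^{\binom{k}{2}}\genfrac{[}{]}{0pt}{}{n}{k}_q=\prod_{j=0}^{n-1}(1+q^j)=\sum_{\mathbf b\in\{0,1\}^n}q^{\mathrm{maj}(\mathbf b)+\mathrm{maj}(\hat{\mathbf b})}, \] where for $\mathbf b=(b_1,\dots,b_n)$, $\hat{\mathbf b}=(1-b_1,\dots,1-b_n)$.
   Context: $\mathrm{maj}(\mathbf b)=\sum\{i\in\{1,\dots,n-1\}: b_i>b_{i+1}\}$. $\genfrac{[}{]}{0pt}{}{n}{k}_q=\frac{[n]_q!}{[k]_q![n-k]_q!}$ with $[n]_q!=\prod_{i=1}^n(1+q+\dots+q^{i-1})$. -}

module Defs where

open import Data.Nat using (ℕ; zero; suc; _+_; _*_; _∸_; _^_; _/_; NonZero)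
open import Data.Nat.Properties using (m*n≢0)
open import Data.Bool using (Bool; true; false; not)
open import Data.Vec using (Vec; []; _∷_; map)
open import Data.List using (List; []; _∷_; _++_) renaming (map to lmap)

Σ< : ℕ → (ℕ → ℕ) → ℕ
Σ< zero    f = 0
Σ< (suc n) f = f 0 + Σ< n (λ j → f (suc j))

Π< : ℕ → (ℕ → ℕ) → ℕ
Π< zero    f = 1
Π< (suc n) f = f 0 * Π< n (λ j → f (suc j))

[_]_ : ℕ → ℕ → ℕ
[ i ] q = Σ< i (λ j → q ^ j)

[_]!_ : ℕ → ℕ → ℕ
[ n ]! q = Π< n (λ i → [ suc i ] q)

Π<≢0 : ∀ n (f : ℕ → ℕ) → (∀ j → NonZero (f j)) → NonZero (Π< n f)
Π<≢0 zero    f h = _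
Π<≢0 (suc n) f h = m*n≢0 (f 0) (Π< n (λ j → f (suc j))) {{h 0}} {{Π<≢0 n (λ j → f (suc j)) (λ j → h (suc j))}}

-- [n]_q! is never zero (each factor [i+1]_q = 1 + q(...) ≥ 1)
qfact≢0 : ∀ n q → NonZero ([ n ]! q)
qfact≢0 n q = Π<≢0 n (λ i → [ suc i ] q) (λ i → _)

-- Gaussian binomial [n choose k]_q = [n]_q! / ([k]_q! [n-k]_q!)
-- (evaluated at a natural number q; the division is exact)
qbinom : ℕ → ℕ → ℕ → ℕ
qbinom n k q = _/_ ([ n ]! q) ([ k ]! q * [ n ∸ k ]! q)
  {{m*n≢0 ([ k ]! q) ([ n ∸ k ]! q) {{qfact≢0 k q}} {{qfact≢0 (n ∸ k) q}}}}

-- binary words b = (b_1,...,b_n) ∈ {0,1}^n, with 0 = false, 1 = true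
-- all words of length n
allWords : (n : ℕ) → List (Vec Bool n)
allWords zero    = [] ∷ []
allWords (suc n) = lmap (false ∷_) (allWords n) ++ lmap (true ∷_) (allWords n)

des : Bool → Bool → Bool
des true false = true
des _    _     = false

-- majFrom i (b_i, b_{i+1}, ...) = Σ { j ≥ i : b_j > b_{j+1} }
majFrom : ∀ {n} → ℕ → Vec Bool n → ℕ
majFrom i []           = 0
majFrom i (x ∷ [])     = 0
majFrom i (x ∷ y ∷ bs) = (if′ des x y then i else 0) + majFrom (suc i) (y ∷ bs)
  where
  if′_then_else_ : Bool → ℕ → ℕ → ℕ
  if′ true  then a else b = a
  if′ false then a else b = b

maj : ∀ {n} → Vec Bool n → ℕ
maj b = majFrom 1 b

hat : ∀ {n} → Vec Bool n → Vec Bool n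
hat b = map not b

sumList : List ℕ → ℕ
sumList []       = 0
sumList (x ∷ xs) = x + sumList xs

module Submission where

-- The Gaussian
--     binomial of the statement is a quotient of q-factorials; we replace it
--     by the polynomial 'gauss q n k' given by the q-Pascal recurrence and show
--     gauss q n k · [k]_q! · [n-k]_q! = [n]_q!, so the two agree for k ≤ n.
--     For 'gauss' we prove Rothe's q-binomial theorem
--         Σ_k q^(k C 2) x^k gauss q n k = Π_{j<n} (1 + x q^j)
--     by induction on n (peeling off the factor 1 + x and replacing x by xq),
--     and specialise to x = 1.
--
-- A position i contributes to
--     exactly one of maj b, maj b̂ precisely when b_i ≠ b_{i+1}, and then it
--     contributes i.  Splitting words by their second letter therefore gives,
--     for the sum over words with fixed first letter and positions counted
--     from i, the recursion  S(n+1, i) = (1 + q^i) S(n, i+1), whence a product.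

open import Defs
open import Data.Nat using (ℕ; zero; suc; _+_; _*_; _∸_; _^_; _≤_; _<_; _/_; z≤n; s≤s)
open import Data.Nat.Properties
open import Data.Nat.DivMod using (m*n/n≡m)
open import Data.Nat.Combinatorics using (_C_; nC1≡n; nCk+nC[k+1]≡[n+1]C[k+1])
open import Data.Nat.Tactic.RingSolver using (solve-∀)
open import Data.Bool using (Bool; true; false)
open import Data.Vec using (Vec; _∷_)
open import Data.List using (List; _++_; map) renaming ([] to []ₗ; _∷_ to _∷ₗ_)
open import Data.List.Properties using (map-++; map-cong; map-∘)
open import Data.Product using (_×_; _,_)
open import Relation.Binary.PropositionalEquality hiding ([_])
open ≡-Reasoning

Σ-cong : ∀ n {f g : ℕ → ℕ} → (∀ j → f j ≡ g j) → Σ< n f ≡ Σ< n g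
Σ-cong zero    h = refl
Σ-cong (suc n) h = cong₂ _+_ (h 0) (Σ-cong n (λ j → h (suc j)))

Σ-cong-< : ∀ n {f g : ℕ → ℕ} → (∀ j → j < n → f j ≡ g j) → Σ< n f ≡ Σ< n g
Σ-cong-< zero    h = refl
Σ-cong-< (suc n) h = cong₂ _+_ (h 0 (s≤s z≤n)) (Σ-cong-< n (λ j j<n → h (suc j) (s≤s j<n)))

Π-cong : ∀ n {f g : ℕ → ℕ} → (∀ j → f j ≡ g j) → Π< n f ≡ Π< n g
Π-cong zero    h = refl
Π-cong (suc n) h = cong₂ _*_ (h 0) (Π-cong n (λ j → h (suc j)))

Σ-+ : ∀ n (f g : ℕ → ℕ) → Σ< n (λ j → f j + g j) ≡ Σ< n f + Σ< n g
Σ-+ zero    f g = refl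
Σ-+ (suc n) f g = trans (cong (f 0 + g 0 +_) (Σ-+ n (λ j → f (suc j)) (λ j → g (suc j))))
                        (interchange (f 0) (g 0) _ _)
  where
  interchange : ∀ a b c d → (a + b) + (c + d) ≡ (a + c) + (b + d)
  interchange = solve-∀

Σ-* : ∀ n c (f : ℕ → ℕ) → Σ< n (λ j → c * f j) ≡ c * Σ< n f
Σ-* zero    c f = sym (*-zeroʳ c)
Σ-* (suc n) c f = trans (cong (c * f 0 +_) (Σ-* n c (λ j → f (suc j))))
                        (sym (*-distribˡ-+ c (f 0) _))

Σ-snoc : ∀ n (f : ℕ → ℕ) → Σ< (suc n) f ≡ Σ< n f + f n
Σ-snoc zero    f = +-comm (f 0) 0
Σ-snoc (suc n) f = trans (cong (f 0 +_) (Σ-snoc n (λ j → f (suc j)))) (sym (+-assoc (f 0) _ _))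

Π-snoc : ∀ n (f : ℕ → ℕ) → Π< (suc n) f ≡ Π< n f * f n
Π-snoc zero    f = trans (*-identityʳ (f 0)) (sym (+-identityʳ (f 0)))
Π-snoc (suc n) f = trans (cong (f 0 *_) (Π-snoc n (λ j → f (suc j)))) (sym (*-assoc (f 0) _ _))

Σ-split : ∀ a b (f : ℕ → ℕ) → Σ< (a + b) f ≡ Σ< a f + Σ< b (λ j → f (a + j))
Σ-split zero    b f = refl
Σ-split (suc a) b f = trans (cong (f 0 +_) (Σ-split a b (λ j → f (suc j)))) (sym (+-assoc (f 0) _ _))

qint-+ : ∀ q a b → [ a + b ] q ≡ [ a ] q + q ^ a * [ b ] q
qint-+ q a b = begin
  [ a + b ] q                                   ≡⟨ Σ-split a b (q ^_) ⟩
  [ a ] q + Σ< b (λ j → q ^ (a + j))            ≡⟨ cong ([ a ] q +_) (Σ-cong b (^-distribˡ-+-* q a)) ⟩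
  [ a ] q + Σ< b (λ j → q ^ a * q ^ j)          ≡⟨ cong ([ a ] q +_) (Σ-* b (q ^ a) (q ^_)) ⟩
  [ a ] q + q ^ a * [ b ] q                     ∎

qfact-suc : ∀ n q → [ suc n ]! q ≡ [ n ]! q * [ suc n ] q
qfact-suc n q = Π-snoc n (λ i → [ suc i ] q)

gauss : ℕ → ℕ → ℕ → ℕ
gauss q n       zero    = 1
gauss q zero    (suc k) = 0
gauss q (suc n) (suc k) = gauss q n k + q ^ suc k * gauss q n (suc k)

gauss-above : ∀ q n k → n < k → gauss q n k ≡ 0
gauss-above q zero    (suc k) _       = refl
gauss-above q (suc n) (suc k) (s≤s p) = begin
  gauss q n k + q ^ suc k * gauss q n (suc k)
    ≡⟨ cong₂ (λ a b → a + q ^ suc k * b) (gauss-above q n k p) (gauss-above q n (suc k) (m<n⇒m<1+n p)) ⟩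
  q ^ suc k * 0
    ≡⟨ *-zeroʳ (q ^ suc k) ⟩
  0 ∎

gauss-diag : ∀ q n → gauss q n n ≡ 1
gauss-diag q zero    = refl
gauss-diag q (suc n) = begin
  gauss q n n + q ^ suc n * gauss q n (suc n)
    ≡⟨ cong₂ (λ a b → a + q ^ suc n * b) (gauss-diag q n) (gauss-above q n (suc n) ≤-refl) ⟩
  1 + q ^ suc n * 0
    ≡⟨ cong suc (*-zeroʳ (q ^ suc n)) ⟩
  1 ∎

-- The defining property of the Gaussian binomial, with n written as k + m:
--   [k+m choose k]_q · [k]_q! · [m]_q! = [k+m]_q!.
gauss-fact : ∀ q k m → gauss q (k + m) k * ([ k ]! q * [ m ]! q) ≡ [ k + m ]! q
gauss-fact q zero    m    = trans (*-identityˡ _) (*-identityˡ _)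
gauss-fact q (suc k) zero = begin
  gauss q (suc k + 0) (suc k) * ([ suc k ]! q * 1)
    ≡⟨ cong (λ t → gauss q t (suc k) * ([ suc k ]! q * 1)) (+-identityʳ (suc k)) ⟩
  gauss q (suc k) (suc k) * ([ suc k ]! q * 1)
    ≡⟨ cong (_* ([ suc k ]! q * 1)) (gauss-diag q (suc k)) ⟩
  1 * ([ suc k ]! q * 1)
    ≡⟨ trans (*-identityˡ _) (*-identityʳ _) ⟩
  [ suc k ]! q
    ≡⟨ cong (λ t → [ t ]! q) (sym (+-identityʳ (suc k))) ⟩
  [ suc k + 0 ]! q ∎
gauss-fact q (suc k) (suc m) = begin
  (a + Q * b) * ([ suc k ]! q * [ suc m ]! q)
    ≡⟨ cong₂ (λ u v → (a + Q * b) * (u * v)) (qfact-suc k q) (qfact-suc m q) ⟩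
  (a + Q * b) * ((F * A) * (M * B))
    ≡⟨ regroup a b F M A B Q ⟩
  (a * (F * (M * B))) * A + Q * B * (b * ((F * A) * M))
    ≡⟨ cong₂ (λ u v → u * A + Q * B * v) left right ⟩
  N * A + Q * B * N
    ≡⟨ factor N A B Q ⟩
  N * (A + Q * B)
    ≡⟨ cong (N *_) (sym (qint-+ q (suc k) (suc m))) ⟩
  N * [ suc n ] q
    ≡⟨ sym (qfact-suc n q) ⟩
  [ suc n ]! q ∎
  where
  n = k + suc m
  a = gauss q n k
  b = gauss q n (suc k)
  Q = q ^ suc k
  F = [ k ]! q
  M = [ m ]! q
  A = [ suc k ] q
  B = [ suc m ] q
  N = [ n ]! q
  regroup : ∀ a b F M A B Q →
    (a + Q * b) * ((F * A) * (M * B)) ≡ (a * (F * (M * B))) * A + Q * B * (b * ((F * A) * M))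
  regroup = solve-∀
  factor : ∀ N A B Q → N * A + Q * B * N ≡ N * (A + Q * B)
  factor = solve-∀
  -- the two induction hypotheses, for (k, m+1) and (k+1, m)
  left : a * (F * (M * B)) ≡ N
  left = trans (cong (λ t → a * (F * t)) (sym (qfact-suc m q))) (gauss-fact q k (suc m))
  right : b * ((F * A) * M) ≡ N
  right = begin
    b * ((F * A) * M)         ≡⟨ cong (λ t → b * (t * M)) (sym (qfact-suc k q)) ⟩
    b * ([ suc k ]! q * M)     ≡⟨ cong (λ t → gauss q t (suc k) * ([ suc k ]! q * M)) (+-suc k m) ⟩
    gauss q (suc k + m) (suc k) * ([ suc k ]! q * M)
                               ≡⟨ gauss-fact q (suc k) m ⟩
    [ suc k + m ]! q          ≡⟨ cong (λ t → [ t ]! q) (sym (+-suc k m)) ⟩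
    N ∎

qbinom≡gauss : ∀ q n k → k ≤ n → qbinom n k q ≡ gauss q n k
qbinom≡gauss q n k k≤n = begin
  _/_ ([ n ]! q) D {{nz}}                  ≡⟨ cong (λ x → _/_ x D {{nz}}) (sym fact) ⟩
  _/_ (gauss q n k * D) D {{nz}}            ≡⟨ m*n/n≡m (gauss q n k) D {{nz}} ⟩
  gauss q n k ∎
  where
  D = [ k ]! q * [ n ∸ k ]! q
  nz = m*n≢0 ([ k ]! q) ([ n ∸ k ]! q) {{qfact≢0 k q}} {{qfact≢0 (n ∸ k) q}}
  fact : gauss q n k * D ≡ [ n ]! q
  fact = subst (λ t → gauss q t k * D ≡ [ t ]! q) (m+[n∸m]≡n k≤n) (gauss-fact q k (n ∸ k))

-- Rothe's q-binomial theorem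

choose2-suc : ∀ k → suc k C 2 ≡ k C 2 + k
choose2-suc k = begin
  suc k C 2          ≡⟨ sym (nCk+nC[k+1]≡[n+1]C[k+1] k 1) ⟩
  k C 1 + k C 2      ≡⟨ cong (_+ k C 2) (nC1≡n k) ⟩
  k + k C 2          ≡⟨ +-comm k (k C 2) ⟩
  k C 2 + k          ∎

^-distrib-* : ∀ x y k → (x * y) ^ k ≡ x ^ k * y ^ k
^-distrib-* x y zero    = refl
^-distrib-* x y (suc k) = trans (cong ((x * y) *_) (^-distrib-* x y k)) (interchange x y (x ^ k) (y ^ k))
  where
  interchange : ∀ x y a b → x * y * (a * b) ≡ x * a * (y * b)
  interchange = solve-∀

rotheTerm : ℕ → ℕ → ℕ → ℕ → ℕ
rotheTerm q n x k = q ^ (k C 2) * (x ^ k * gauss q n k)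

-- q-Pascal on terms: the (k+1)-st term for n+1 at x splits into the k-th and
-- (k+1)-st terms for n at xq.
rotheTerm-suc : ∀ q n x k →
  rotheTerm q (suc n) x (suc k) ≡ x * rotheTerm q n (x * q) k + rotheTerm q n (x * q) (suc k)
rotheTerm-suc q n x k = begin
  q ^ (suc k C 2) * (x * x ^ k * (g + q * q ^ k * g′))
    ≡⟨ cong (λ t → q ^ t * (x * x ^ k * (g + q * q ^ k * g′))) (choose2-suc k) ⟩
  q ^ (k C 2 + k) * (x * x ^ k * (g + q * q ^ k * g′))
    ≡⟨ cong (_* (x * x ^ k * (g + q * q ^ k * g′))) (^-distribˡ-+-* q (k C 2) k) ⟩
  c * q ^ k * (x * x ^ k * (g + q * q ^ k * g′))
    ≡⟨ distribute c (q ^ k) x (x ^ k) q g g′ ⟩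
  x * (c * ((x ^ k * q ^ k) * g)) + c * q ^ k * ((x * q) * (x ^ k * q ^ k) * g′)
    ≡⟨ cong (λ t → x * (c * (t * g)) + c * q ^ k * ((x * q) * t * g′)) (sym (^-distrib-* x q k)) ⟩
  x * rotheTerm q n (x * q) k + c * q ^ k * ((x * q) ^ suc k * g′)
    ≡⟨ cong (λ t → x * rotheTerm q n (x * q) k + t * ((x * q) ^ suc k * g′)) (sym (^-distribˡ-+-* q (k C 2) k)) ⟩
  x * rotheTerm q n (x * q) k + q ^ (k C 2 + k) * ((x * q) ^ suc k * g′)
    ≡⟨ cong (λ t → x * rotheTerm q n (x * q) k + q ^ t * ((x * q) ^ suc k * g′)) (sym (choose2-suc k)) ⟩
  x * rotheTerm q n (x * q) k + rotheTerm q n (x * q) (suc k) ∎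
  where
  c = q ^ (k C 2)
  g = gauss q n k
  g′ = gauss q n (suc k)
  distribute : ∀ c Q x X q g g′ →
    c * Q * (x * X * (g + q * Q * g′)) ≡ x * (c * ((X * Q) * g)) + c * Q * ((x * q) * (X * Q) * g′)
  distribute = solve-∀

-- Shifting the summation index: the term of index n+1 vanishes.
rothe-shift : ∀ q n y → 1 + Σ< (suc n) (λ k → rotheTerm q n y (suc k)) ≡ Σ< (suc n) (rotheTerm q n y)
rothe-shift q n y = begin
  Σ< (suc (suc n)) (rotheTerm q n y)
    ≡⟨ Σ-snoc (suc n) (rotheTerm q n y) ⟩
  S + q ^ (suc n C 2) * (y ^ suc n * gauss q n (suc n))
    ≡⟨ cong (λ t → S + q ^ (suc n C 2) * (y ^ suc n * t)) (gauss-above q n (suc n) ≤-refl) ⟩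
  S + q ^ (suc n C 2) * (y ^ suc n * 0)
    ≡⟨ cong (λ t → S + q ^ (suc n C 2) * t) (*-zeroʳ (y ^ suc n)) ⟩
  S + q ^ (suc n C 2) * 0
    ≡⟨ cong (S +_) (*-zeroʳ (q ^ (suc n C 2))) ⟩
  S + 0
    ≡⟨ +-identityʳ S ⟩
  S ∎
  where S = Σ< (suc n) (rotheTerm q n y)

rothe : ∀ q n x → Σ< (suc n) (rotheTerm q n x) ≡ Π< n (λ j → 1 + x * q ^ j)
rothe q zero    x = refl
rothe q (suc n) x = begin
  1 + Σ< (suc n) (λ k → rotheTerm q (suc n) x (suc k))
    ≡⟨ cong (1 +_) (Σ-cong (suc n) (rotheTerm-suc q n x)) ⟩
  1 + Σ< (suc n) (λ k → x * rotheTerm q n y k + rotheTerm q n y (suc k))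
    ≡⟨ cong (1 +_) (Σ-+ (suc n) (λ k → x * rotheTerm q n y k) (λ k → rotheTerm q n y (suc k))) ⟩
  1 + (Σ< (suc n) (λ k → x * rotheTerm q n y k) + T)
    ≡⟨ cong (λ t → 1 + (t + T)) (Σ-* (suc n) x (rotheTerm q n y)) ⟩
  1 + (x * S + T)
    ≡⟨ rearrange x S T ⟩
  x * S + (1 + T)
    ≡⟨ cong (x * S +_) (rothe-shift q n y) ⟩
  x * S + S
    ≡⟨ +-comm (x * S) S ⟩
  (1 + x) * S
    ≡⟨ cong₂ (λ u v → (1 + u) * v) (sym (*-identityʳ x)) (rothe q n y) ⟩
  (1 + x * q ^ 0) * Π< n (λ j → 1 + y * q ^ j)
    ≡⟨ cong ((1 + x * q ^ 0) *_) (Π-cong n (λ j → cong (1 +_) (*-assoc x q (q ^ j)))) ⟩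
  Π< (suc n) (λ j → 1 + x * q ^ j) ∎
  where
  y = x * q
  S = Σ< (suc n) (rotheTerm q n y)
  T = Σ< (suc n) (λ k → rotheTerm q n y (suc k))
  rearrange : ∀ x s t → 1 + (x * s + t) ≡ x * s + (1 + t)
  rearrange = solve-∀

qbinomial-sum : ∀ n q → Σ< (suc n) (λ k → q ^ (k C 2) * qbinom n k q) ≡ Π< n (λ j → 1 + q ^ j)
qbinomial-sum n q = begin
  Σ< (suc n) (λ k → q ^ (k C 2) * qbinom n k q)
    ≡⟨ Σ-cong-< (suc n) (λ k k≤n → cong (q ^ (k C 2) *_) (term k (≤-pred k≤n))) ⟩
  Σ< (suc n) (rotheTerm q n 1)
    ≡⟨ rothe q n 1 ⟩
  Π< n (λ j → 1 + 1 * q ^ j)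
    ≡⟨ Π-cong n (λ j → cong (1 +_) (*-identityˡ (q ^ j))) ⟩
  Π< n (λ j → 1 + q ^ j) ∎
  where
  term : ∀ k → k ≤ n → qbinom n k q ≡ 1 ^ k * gauss q n k
  term k k≤n = begin
    qbinom n k q          ≡⟨ qbinom≡gauss q n k k≤n ⟩
    gauss q n k           ≡⟨ sym (*-identityˡ _) ⟩
    1 * gauss q n k       ≡⟨ cong (_* gauss q n k) (sym (^-zeroˡ k)) ⟩
    1 ^ k * gauss q n k   ∎

sumList-++ : ∀ xs ys → sumList (xs ++ ys) ≡ sumList xs + sumList ys
sumList-++ []ₗ       ys = refl
sumList-++ (x ∷ₗ xs) ys = trans (cong (x +_) (sumList-++ xs ys)) (sym (+-assoc x _ _))

sumList-* : ∀ {A : Set} c (f : A → ℕ) (xs : List A) →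
  sumList (map (λ x → c * f x) xs) ≡ c * sumList (map f xs)
sumList-* c f []ₗ       = sym (*-zeroʳ c)
sumList-* c f (x ∷ₗ xs) = trans (cong (c * f x +_) (sumList-* c f xs)) (sym (*-distribˡ-+ c (f x) _))

sum-words : ∀ n (h : Vec Bool (suc n) → ℕ) →
  sumList (map h (allWords (suc n)))
    ≡ sumList (map (λ w → h (false ∷ w)) (allWords n)) + sumList (map (λ w → h (true ∷ w)) (allWords n))
sum-words n h = begin
  sumList (map h (map (false ∷_) ws ++ map (true ∷_) ws))
    ≡⟨ cong sumList (map-++ h (map (false ∷_) ws) (map (true ∷_) ws)) ⟩
  sumList (map h (map (false ∷_) ws) ++ map h (map (true ∷_) ws))
    ≡⟨ sumList-++ (map h (map (false ∷_) ws)) _ ⟩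
  sumList (map h (map (false ∷_) ws)) + sumList (map h (map (true ∷_) ws))
    ≡⟨ cong₂ (λ u v → sumList u + sumList v) (sym (map-∘ ws)) (sym (map-∘ ws)) ⟩
  sumList (map (λ w → h (false ∷ w)) ws) + sumList (map (λ w → h (true ∷ w)) ws) ∎
  where ws = allWords n

-- The joint statistic maj b + maj b̂

-- Contribution of position i with letters c, d at positions i, i+1 to
-- maj b + maj b̂: a descent of b or of b̂ happens there iff c ≠ d.
flipWeight : Bool → Bool → ℕ → ℕ
flipWeight false false i = 0
flipWeight true  true  i = 0
flipWeight false true  i = i
flipWeight true  false i = i

majPair-step : ∀ {n} i c d (w : Vec Bool n) →
  majFrom i (c ∷ d ∷ w) + majFrom i (hat (c ∷ d ∷ w))
    ≡ flipWeight c d i + (majFrom (suc i) (d ∷ w) + majFrom (suc i) (hat (d ∷ w)))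
majPair-step i false false w = refl
majPair-step i true  true  w = refl
majPair-step i false true  w = swap-middle (majFrom (suc i) (true ∷ w)) i _
  where
  swap-middle : ∀ a b c → a + (b + c) ≡ b + (a + c)
  swap-middle = solve-∀
majPair-step i true  false w = +-assoc i _ _

pairSum : ℕ → ℕ → ℕ → Bool → ℕ
pairSum q n i c = sumList (map (λ w → q ^ (majFrom i (c ∷ w) + majFrom i (hat (c ∷ w)))) (allWords n))

pairSum-second : ∀ q n i c d →
  sumList (map (λ w → q ^ (majFrom i (c ∷ d ∷ w) + majFrom i (hat (c ∷ d ∷ w)))) (allWords n))
    ≡ q ^ flipWeight c d i * pairSum q n (suc i) d
pairSum-second q n i c d = begin
  sumList (map (λ w → q ^ (majFrom i (c ∷ d ∷ w) + majFrom i (hat (c ∷ d ∷ w)))) ws)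
    ≡⟨ cong sumList (map-cong (λ w → cong (q ^_) (majPair-step i c d w)) ws) ⟩
  sumList (map (λ w → q ^ (flipWeight c d i + e w)) ws)
    ≡⟨ cong sumList (map-cong (λ w → ^-distribˡ-+-* q (flipWeight c d i) (e w)) ws) ⟩
  sumList (map (λ w → q ^ flipWeight c d i * q ^ e w) ws)
    ≡⟨ sumList-* (q ^ flipWeight c d i) (λ w → q ^ e w) ws ⟩
  q ^ flipWeight c d i * pairSum q n (suc i) d ∎
  where
  ws = allWords n
  e : Vec Bool n → ℕ
  e w = majFrom (suc i) (d ∷ w) + majFrom (suc i) (hat (d ∷ w))

-- Exactly one of the two choices of d gives a flip: q^0 + q^i either way.
flip-pair : ∀ q i c X → q ^ flipWeight c false i * X + q ^ flipWeight c true i * X ≡ (1 + q ^ i) * X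
flip-pair q i false X = sym (*-distribʳ-+ X 1 (q ^ i))
flip-pair q i true  X = trans (+-comm (q ^ i * X) (1 * X)) (sym (*-distribʳ-+ X 1 (q ^ i)))

shiftedProd : ℕ → ℕ → ℕ → ℕ
shiftedProd q n i = Π< n (λ j → 1 + q ^ (i + j))

shiftedProd-suc : ∀ q n i → shiftedProd q (suc n) i ≡ (1 + q ^ i) * shiftedProd q n (suc i)
shiftedProd-suc q n i =
  cong₂ (λ u v → (1 + q ^ u) * v) (+-identityʳ i) (Π-cong n (λ j → cong (λ t → 1 + q ^ t) (+-suc i j)))

pairSum-prod : ∀ q n i c → pairSum q n i c ≡ shiftedProd q n i
pairSum-prod q zero    i c = refl
pairSum-prod q (suc n) i c = begin
  pairSum q (suc n) i c
    ≡⟨ sum-words n (λ w → q ^ (majFrom i (c ∷ w) + majFrom i (hat (c ∷ w)))) ⟩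
  sumList (map (λ w → q ^ (majFrom i (c ∷ false ∷ w) + majFrom i (hat (c ∷ false ∷ w)))) (allWords n))
    + sumList (map (λ w → q ^ (majFrom i (c ∷ true ∷ w) + majFrom i (hat (c ∷ true ∷ w)))) (allWords n))
    ≡⟨ cong₂ _+_ (pairSum-second q n i c false) (pairSum-second q n i c true) ⟩
  q ^ flipWeight c false i * pairSum q n (suc i) false + q ^ flipWeight c true i * pairSum q n (suc i) true
    ≡⟨ cong₂ (λ u v → q ^ flipWeight c false i * u + q ^ flipWeight c true i * v)
             (pairSum-prod q n (suc i) false) (pairSum-prod q n (suc i) true) ⟩
  q ^ flipWeight c false i * P + q ^ flipWeight c true i * P
    ≡⟨ flip-pair q i c P ⟩
  (1 + q ^ i) * P
    ≡⟨ sym (shiftedProd-suc q n i) ⟩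
  shiftedProd q (suc n) i ∎
  where P = shiftedProd q n (suc i)

-- Second half of the theorem: split by the first letter; each half is
-- Π_{1≤j≤n} (1 + q^j), and 2 · Π_{1≤j≤n} is the product with the j = 0 factor.
majPair-sum : ∀ n q → Π< n (λ j → 1 + q ^ j) ≡ sumList (map (λ b → q ^ (maj b + maj (hat b))) (allWords n))
majPair-sum zero    q = refl
majPair-sum (suc n) q = sym (begin
  sumList (map (λ b → q ^ (maj b + maj (hat b))) (allWords (suc n)))
    ≡⟨ sum-words n (λ b → q ^ (maj b + maj (hat b))) ⟩
  pairSum q n 1 false + pairSum q n 1 true
    ≡⟨ cong₂ _+_ (pairSum-prod q n 1 false) (pairSum-prod q n 1 true) ⟩
  shiftedProd q n 1 + shiftedProd q n 1
    ≡⟨ cong (shiftedProd q n 1 +_) (sym (+-identityʳ _)) ⟩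
  Π< (suc n) (λ j → 1 + q ^ j) ∎)

lemma6p2 : ∀ (n : ℕ) → 1 ≤ n → ∀ (q : ℕ) →
    (Σ< (suc n) (λ k → q ^ (k C 2) * qbinom n k q) ≡ Π< n (λ j → 1 + q ^ j))
    × (Π< n (λ j → 1 + q ^ j) ≡ sumList (map (λ b → q ^ (maj b + maj (hat b))) (allWords n)))
lemma6p2 n _ q = qbinomial-sum n q , majPair-sum n q
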